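{- Let $p$ be a prime with $p\equiv 11\pmod{12}$, and let $G$ be the Eberhard graph with parameter $p$. Then $\overline{G}$ has a model of $K_{\chi(\overline{G})}$ in which every branch set has at most two vertices.
   Context: For a prime $p\equiv 11\pmod{12}$, let $S=\{(x,x^2),(x,-x^2): x\in\mathbb{F}_p\setminus\{0\}\}\subseteq\mathbb{F}_p\times\mathbb{F}_p$. The Eberhard graph with parameter $p$ is the Cayley graph with vertex set $\mathbb{F}_p\times\mathbb{F}_p$ in which $u$ and $v$ are adjacent iff $u-v\in S$. $\overline{G}$ denotes the complement. A model of $K_t$ in a graph is a collection of $t$ pairwise disjoint vertex sets (branch sets), each inducing a connected subgraph, with an edge between every two of them. -}

module Defs where

open import Level using (0ℓ)
open import Data.Nat using (ℕ; _+_; _*_; _≤_; _<_)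
open import Data.Fin using (Fin; toℕ)
open import Data.Product using (_×_; _,_; Σ; ∃; ∃-syntax)
open import Data.Sum using (_⊎_)
open import Data.List using (List; length)
open import Data.List.Membership.Propositional using (_∈_; _∉_)
open import Data.List.Relation.Unary.Unique.Propositional using (Unique)
open import Relation.Binary.PropositionalEquality using (_≡_; _≢_)
open import Relation.Nullary using (¬_)

record Graph (V : Set) : Set₁ where
  field
    Adj : V → V → Set

open Graph public

infix 4 _≡_[mod_]
_≡_[mod_] : ℕ → ℕ → ℕ → Set
a ≡ b [mod p ] = ∃[ k ] ∃[ l ] (a + k * p ≡ b + l * p)

-- Elements of 𝔽_p are represented by Fin p (residues 0..p-1).
Vtx : ℕ → Set
Vtx p = Fin p × Fin p

-- u - v ∈ S, where S = {(x, x²), (x, -x²) : x ∈ 𝔽_p, x ≠ 0}.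
InS : (p : ℕ) → Vtx p → Vtx p → Set
InS p (u₁ , u₂) (v₁ , v₂) =
  ∃[ x ] (1 ≤ x × x < p ×
          (toℕ u₁ ≡ toℕ v₁ + x [mod p ]) ×
          ((toℕ u₂ ≡ toℕ v₂ + x * x [mod p ]) ⊎ (toℕ u₂ + x * x ≡ toℕ v₂ [mod p ])))

Eberhard : (p : ℕ) → Graph (Vtx p)
Eberhard p = record { Adj = InS p }

complement : {V : Set} → Graph V → Graph V
complement G = record { Adj = λ u v → u ≢ v × ¬ Adj G u v }

Colourable : {V : Set} → Graph V → ℕ → Set
Colourable {V} G k = Σ (V → Fin k) λ c → ∀ u v → Adj G u v → c u ≢ c v

IsChromaticNumber : {V : Set} → Graph V → ℕ → Set
IsChromaticNumber G k = Colourable G k × (∀ m → m < k → ¬ Colourable G m)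

data WalkIn {V : Set} (G : Graph V) (B : List V) : V → V → Set where
  here : ∀ {u} → u ∈ B → WalkIn G B u u
  step : ∀ {u w v} → u ∈ B → Adj G u w → WalkIn G B w v → WalkIn G B u v

InducesConnected : {V : Set} → Graph V → List V → Set
InducesConnected {V} G B = (∃[ u ] (u ∈ B)) × (∀ u v → u ∈ B → v ∈ B → WalkIn G B u v)

record KModel {V : Set} (G : Graph V) (t : ℕ) : Set where
  field
    branch    : Fin t → List V
    unique    : ∀ i → Unique (branch i)
    connected : ∀ i → InducesConnected G (branch i)
    disjoint  : ∀ i j → i ≢ j → ∀ v → v ∈ branch i → v ∉ branch j
    adjacent  : ∀ i j → i ≢ j → ∃[ u ] ∃[ v ] (u ∈ branch i × v ∈ branch j × Adj G u v)

open KModel public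

-- Write p = 2m + 1; of the hypothesis p ≡ 11 (mod 12) only that p is prime and m > 2 is used.
--
-- In the coordinates t = (a - b)/2, h = (a + b)/2 of a vertex (a, b), the sets
-- {(t, 2i + 1), (t, 2i + 2)}, {(2i, 0), (2i + 1, 0)} (0 ≤ i < m) and {(2m, 0)} partition 𝔽_p²
-- into K = pm + m + 1 cliques of G, because the two points of each set differ by (±1, ±1) ∈ S
-- in the original coordinates.  Colouring every vertex by its set shows χ(Ḡ) ≤ K.
--
-- The sets {(a, a + j), (a, a - j)} (a ∈ 𝔽_p, 1 ≤ j ≤ m), {(j, j), (j + m, j + m)}
-- (1 ≤ j ≤ m) and {(0, 0)} also partition 𝔽_p² into K sets, each connected in Ḡ, and any two of
-- them are joined by a non-edge of G.  A vertex outside column a that is S-adjacent to both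
-- (a, a ± j) lies at the same horizontal distance x from both, so its second coordinate differs
-- from a + j and a - j by x² and -x², forcing it to be a.  A diagonal point S-adjacent to (e, e)
-- satisfies x = ±x², so (p being prime) it differs from (e, e) by ±(1, 1); this cannot hold for
-- both e and e + m.  Any χ(Ḡ) ≤ K of these sets form the required model.

module Submission where

open import Defs
open import Data.Nat using (ℕ; _≤_; _%_)
open import Data.Nat.Primality using (Prime)
open import Data.List using (length)
open import Data.Product using (Σ; _×_)
open import Relation.Binary.PropositionalEquality using (_≡_)

open import Data.Empty using (⊥-elim)
open import Data.Fin as Fin using (Fin; toℕ; fromℕ<)
open import Data.Fin.Properties
  using (toℕ<n; toℕ-injective; toℕ-fromℕ<; fromℕ<-injective; inject≤-injective; +↔⊎; *↔×)
open import Data.Integer using (ℤ; +_; -[1+_]; _+_; _*_; _-_; -_; 0ℤ; 1ℤ; -1ℤ; ∣_∣)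
open import Data.Integer.DivMod using (_%ℕ_; _/ℕ_; n%ℕd<d; a≡a%ℕn+[a/ℕn]*n)
open import Data.Integer.Divisibility.Signed
  using (_∣_; divides; _∣?_; ∣-refl; ∣m∣n⇒∣m+n; ∣m∣n⇒∣m-n; ∣m⇒∣-m; ∣n⇒∣m*n; ∣ᵤ⇒∣; ∣⇒∣ᵤ)
import Data.Integer.Properties as ℤ
open import Data.Integer.Tactic.RingSolver using (solve-∀)
open import Data.List using (List; _∷_; [])
open import Data.List.Membership.Propositional using (_∈_)
open import Data.List.Relation.Unary.All using ([]; _∷_)
open import Data.List.Relation.Unary.AllPairs using ([]; _∷_)
open import Data.List.Relation.Unary.Any using (here; there)
open import Data.List.Relation.Unary.Unique.Propositional using (Unique)
open import Data.Nat as ℕ using (zero; suc; NonZero; _<_; _<?_; z≤n; s≤s; ⌊_/2⌋)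
open import Data.Nat.DivMod using (_/_; [m+kn]%n≡m%n; m<n⇒m%n≡m; m≡m%n+[m/n]*n)
import Data.Nat.Divisibility as ℕ
open import Data.Nat.Primality using (euclidsLemma)
import Data.Nat.Properties as ℕ
import Data.Nat.Tactic.RingSolver as ℕ-Solver
open import Data.Product using (∃-syntax; _,_; proj₁; proj₂)
open import Data.Sum as Sum using (_⊎_; inj₁; inj₂)
open import Data.Sum.Function.Propositional using (_⊎-↔_)
open import Function using (_∘_)
open import Function.Bundles using (Injection; _↣_; _↔_; mk↣; mk↔ₛ′)
open import Function.Construct.Composition using (_↣-∘_)
open import Function.Properties.Inverse using (↔-refl; ↔-sym; ↔-trans; ↔⇒↣)
open import Level using (0ℓ)
open import Relation.Binary.Bundles using (Setoid)
open import Relation.Binary.PropositionalEquality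
  using (_≢_; refl; sym; trans; cong; cong₂; subst; module ≡-Reasoning)
import Relation.Binary.Reasoning.Setoid as SetoidReasoning
open import Relation.Nullary using (Dec; yes; no; ¬_)
open import Relation.Nullary.Decidable using (map′; _×-dec_; _⊎-dec_)

module _ {V : Set} {G : Graph V} where

  singleton-connected : ∀ u → InducesConnected G (u ∷ [])
  singleton-connected u = (u , here refl) , walk
    where
    walk : ∀ x y → x ∈ u ∷ [] → y ∈ u ∷ [] → WalkIn G (u ∷ []) x y
    walk _ _ (here refl) (here refl) = here (here refl)

  pair-connected : ∀ {u v} → Adj G u v → Adj G v u → InducesConnected G (u ∷ v ∷ [])
  pair-connected {u} {v} uv vu = (u , here refl) , walk
    where
    walk : ∀ x y → x ∈ u ∷ v ∷ [] → y ∈ u ∷ v ∷ [] → WalkIn G (u ∷ v ∷ []) x y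
    walk _ _ (here refl)         (here refl)         = here (here refl)
    walk _ _ (here refl)         (there (here refl)) = step (here refl) uv (here (there (here refl)))
    walk _ _ (there (here refl)) (here refl)         = step (there (here refl)) vu (here (here refl))
    walk _ _ (there (here refl)) (there (here refl)) = here (there (here refl))

  chromatic-number-≤ : ∀ {k c} → IsChromaticNumber G k → Colourable G c → k ≤ c
  chromatic-number-≤ (_ , minimal) colourable = ℕ.≮⇒≥ (λ c<k → minimal _ c<k colourable)

record Model {V : Set} (G : Graph V) (I : Set) : Set where
  field
    branch    : I → List V
    unique    : ∀ i → Unique (branch i)
    connected : ∀ i → InducesConnected G (branch i)
    disjoint  : ∀ i j → i ≢ j → ∀ v → v ∈ branch i → ¬ v ∈ branch j
    adjacent  : ∀ i j → i ≢ j → ∃[ u ] ∃[ v ] (u ∈ branch i × v ∈ branch j × Adj G u v)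

open Model

Model⇒KModel : ∀ {V} {G : Graph V} {I t} → Model G I → Fin t ↣ I → KModel G t
Model⇒KModel M f = record
  { branch    = branch M ∘ to
  ; unique    = unique M ∘ to
  ; connected = connected M ∘ to
  ; disjoint  = λ i j i≢j → disjoint M (to i) (to j) (i≢j ∘ injective)
  ; adjacent  = λ i j i≢j → adjacent M (to i) (to j) (i≢j ∘ injective)
  }
  where open Injection f

module Congruence (p : ℕ) .{{_ : NonZero p}} where

  infix 4 _≋_ _≋±_ _≋?_

  record _≋_ (a b : ℤ) : Set where
    constructor mk≋
    field p∣a-b : + p ∣ a - b

  open _≋_ public

  _≋±_ : ℤ → ℤ → Set
  a ≋± b = a ≋ b ⊎ a ≋ - b

  ≋-by : ∀ {c a b} → + p ∣ c → c ≡ a - b → a ≋ b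
  ≋-by p∣c refl = mk≋ p∣c

  ≋-reflexive : ∀ {a b} → a ≡ b → a ≋ b
  ≋-reflexive {a} refl = mk≋ (divides 0ℤ (ℤ.+-inverseʳ a))

  ≋-refl : ∀ {a} → a ≋ a
  ≋-refl = ≋-reflexive refl

  ≋-sym : ∀ {a b} → a ≋ b → b ≋ a
  ≋-sym {a} {b} (mk≋ d) = ≋-by (∣m⇒∣-m d) (identity a b)
    where
    identity : ∀ a b → - (a - b) ≡ b - a
    identity = solve-∀

  ≋-trans : ∀ {a b c} → a ≋ b → b ≋ c → a ≋ c
  ≋-trans {a} {b} {c} (mk≋ d) (mk≋ e) = ≋-by (∣m∣n⇒∣m+n d e) (identity a b c)
    where
    identity : ∀ a b c → (a - b) + (b - c) ≡ a - c
    identity = solve-∀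

  ≋-setoid : Setoid 0ℓ 0ℓ
  ≋-setoid = record
    { Carrier = ℤ
    ; _≈_ = _≋_
    ; isEquivalence = record { refl = ≋-refl ; sym = ≋-sym ; trans = ≋-trans }
    }

  module ≋-Reasoning = SetoidReasoning ≋-setoid

  +-cong : ∀ {a b c d} → a ≋ b → c ≋ d → a + c ≋ b + d
  +-cong {a} {b} {c} {d} (mk≋ e) (mk≋ f) = ≋-by (∣m∣n⇒∣m+n e f) (identity a b c d)
    where
    identity : ∀ a b c d → (a - b) + (c - d) ≡ (a + c) - (b + d)
    identity = solve-∀

  *-cong : ∀ {a b c d} → a ≋ b → c ≋ d → a * c ≋ b * d
  *-cong {a} {b} {c} {d} (mk≋ e) (mk≋ f) = ≋-by (∣m∣n⇒∣m+n (∣n⇒∣m*n c e) (∣n⇒∣m*n b f)) (identity a b c d)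
    where
    identity : ∀ a b c d → c * (a - b) + b * (c - d) ≡ a * c - b * d
    identity = solve-∀

  -‿cong : ∀ {a b} → a ≋ b → - a ≋ - b
  -‿cong {a} {b} (mk≋ e) = ≋-by (∣m⇒∣-m e) (identity a b)
    where
    identity : ∀ a b → - (a - b) ≡ - a - - b
    identity = solve-∀

  multiple≋0 : ∀ k → k * + p ≋ 0ℤ
  multiple≋0 k = ≋-by (∣n⇒∣m*n k ∣-refl) (sym (ℤ.+-identityʳ (k * + p)))

  _≋?_ : ∀ a b → Dec (a ≋ b)
  a ≋? b = map′ mk≋ p∣a-b (+ p ∣? (a - b))

  +multiple≋ : ∀ a k → a + k * + p ≋ a
  +multiple≋ a k = ≋-trans (+-cong (≋-refl {a}) (multiple≋0 k)) (≋-reflexive (ℤ.+-identityʳ a))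

  %ℕ-≋ : ∀ z → + (z %ℕ p) ≋ z
  %ℕ-≋ z = ≋-sym (≋-trans (≋-reflexive (a≡a%ℕn+[a/ℕn]*n z p)) (+multiple≋ _ (z /ℕ p)))

  ≡[mod]⇒≋ : ∀ {a b} → a ≡ b [mod p ] → + a ≋ + b
  ≡[mod]⇒≋ {a} {b} (k , l , eq) = begin
    + a                   ≈⟨ +multiple≋ (+ a) (+ k) ⟨
    + a + + k * + p       ≡⟨ embed a k ⟨
    + (a ℕ.+ k ℕ.* p)     ≡⟨ cong +_ eq ⟩
    + (b ℕ.+ l ℕ.* p)     ≡⟨ embed b l ⟩
    + b + + l * + p       ≈⟨ +multiple≋ (+ b) (+ l) ⟩
    + b                   ∎
    where
    open ≋-Reasoning
    embed : ∀ a k → + (a ℕ.+ k ℕ.* p) ≡ + a + + k * + p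
    embed a k = cong (_+_ (+ a)) (ℤ.pos-* k p)

  ≋⇒≡[mod] : ∀ {a b} → + a ≋ + b → a ≡ b [mod p ]
  ≋⇒≡[mod] {a} {b} (mk≋ (divides (+ n) eq)) = 0 , n , ℤ.+-injective (begin
    + (a ℕ.+ 0)           ≡⟨ cong +_ (ℕ.+-identityʳ a) ⟩
    + a                   ≡⟨ identity (+ a) (+ b) ⟩
    + b + (+ a - + b)     ≡⟨ cong (_+_ (+ b)) eq ⟩
    + b + + n * + p       ≡⟨ cong (_+_ (+ b)) (ℤ.pos-* n p) ⟨
    + (b ℕ.+ n ℕ.* p)     ∎)
    where
    open ≡-Reasoning
    identity : ∀ a b → a ≡ b + (a - b)
    identity = solve-∀
  ≋⇒≡[mod] {a} {b} (mk≋ (divides -[1+ n ] eq)) = suc n , 0 , ℤ.+-injective (begin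
    + (a ℕ.+ suc n ℕ.* p)                    ≡⟨ cong (_+_ (+ a)) (ℤ.pos-* (suc n) p) ⟩
    + a + + suc n * + p                      ≡⟨ identity (+ a) (+ b) (+ suc n) (+ p) ⟩
    + b + ((+ a - + b) + + suc n * + p)      ≡⟨ cong (λ d → + b + (d + + suc n * + p)) eq ⟩
    + b + (-[1+ n ] * + p + + suc n * + p)
      ≡⟨ cong (λ d → + b + (d + + suc n * + p)) (ℤ.neg-distribˡ-* (+ suc n) (+ p)) ⟨
    + b + (- (+ suc n * + p) + + suc n * + p) ≡⟨ cong (_+_ (+ b)) (ℤ.+-inverseˡ (+ suc n * + p)) ⟩
    + b + 0ℤ                                 ≡⟨⟩
    + (b ℕ.+ 0 ℕ.* p)                        ∎)
    where
    open ≡-Reasoning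
    identity : ∀ a b k q → a + k * q ≡ b + ((a - b) + k * q)
    identity = solve-∀

  ≡[mod]? : ∀ a b → Dec (a ≡ b [mod p ])
  ≡[mod]? a b = map′ ≋⇒≡[mod] ≡[mod]⇒≋ (+ a ≋? + b)

  ≋⇒≡ : ∀ {a b} → a < p → b < p → + a ≋ + b → a ≡ b
  ≋⇒≡ {a} {b} a<p b<p a≋b with ≋⇒≡[mod] a≋b
  ... | k , l , eq = begin
    a                   ≡⟨ m<n⇒m%n≡m a<p ⟨
    a % p               ≡⟨ [m+kn]%n≡m%n a k p ⟨
    (a ℕ.+ k ℕ.* p) % p ≡⟨ cong (_% p) eq ⟩
    (b ℕ.+ l ℕ.* p) % p ≡⟨ [m+kn]%n≡m%n b l p ⟩
    b % p               ≡⟨ m<n⇒m%n≡m b<p ⟩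
    b                   ∎
    where open ≡-Reasoning


  a≋b+c⇒a-b≋c : ∀ {a b c} → a ≋ b + c → a - b ≋ c
  a≋b+c⇒a-b≋c {a} {b} {c} e = ≋-by (p∣a-b e) (identity a b c)
    where
    identity : ∀ a b c → a - (b + c) ≡ (a - b) - c
    identity = solve-∀

  a-b≋c⇒a≋b+c : ∀ {a b c} → a - b ≋ c → a ≋ b + c
  a-b≋c⇒a≋b+c {a} {b} {c} e = ≋-by (p∣a-b e) (identity a b c)
    where
    identity : ∀ a b c → (a - b) - c ≡ a - (b + c)
    identity = solve-∀

  a+c≋b⇒a-b≋-c : ∀ {a b c} → a + c ≋ b → a - b ≋ - c
  a+c≋b⇒a-b≋-c {a} {b} {c} e = ≋-by (p∣a-b e) (identity a b c)
    where
    identity : ∀ a b c → (a + c) - b ≡ (a - b) - - c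
    identity = solve-∀

  a-b≋-c⇒a+c≋b : ∀ {a b c} → a - b ≋ - c → a + c ≋ b
  a-b≋-c⇒a+c≋b {a} {b} {c} e = ≋-by (p∣a-b e) (identity a b c)
    where
    identity : ∀ a b c → (a - b) - - c ≡ (a + c) - b
    identity = solve-∀

  sub-cong : ∀ {a b c d} → a ≋ b → c ≋ d → a - c ≋ b - d
  sub-cong e f = +-cong e (-‿cong f)

  -a≋b⇒a≋-b : ∀ {a b} → - a ≋ b → a ≋ - b
  -a≋b⇒a≋-b {a} e = ≋-trans (≋-reflexive (sym (ℤ.neg-involutive a))) (-‿cong e)

  ≋±-respˡ : ∀ {a a′ b} → a ≋ a′ → a′ ≋± b → a ≋± b
  ≋±-respˡ e = Sum.map (≋-trans e) (≋-trans e)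

  ≋±-respʳ : ∀ {a b b′} → b ≋ b′ → a ≋± b → a ≋± b′
  ≋±-respʳ e = Sum.map (λ f → ≋-trans f e) (λ f → ≋-trans f (-‿cong e))

  -‿≋± : ∀ {a b} → a ≋± b → - a ≋± b
  -‿≋± (inj₁ e) = inj₂ (-‿cong e)
  -‿≋± {b = b} (inj₂ e) = inj₁ (≋-trans (-‿cong e) (≋-reflexive (ℤ.neg-involutive b)))

  ≋±-cancel : ∀ {a b c} → a ≋± b → a ≋± c → b ≋± c
  ≋±-cancel (inj₁ e) (inj₁ f) = inj₁ (≋-trans (≋-sym e) f)
  ≋±-cancel (inj₁ e) (inj₂ f) = inj₂ (≋-trans (≋-sym e) f)
  ≋±-cancel (inj₂ e) (inj₁ f) = inj₂ (-a≋b⇒a≋-b (≋-trans (≋-sym e) f))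
  ≋±-cancel {c = c} (inj₂ e) (inj₂ f) =
    inj₁ (≋-trans (-a≋b⇒a≋-b (≋-trans (≋-sym e) f)) (≋-reflexive (ℤ.neg-involutive c)))

Close : ℕ → ℕ → Set
Close m n = m ≡ n ⊎ m ≡ suc n ⊎ suc m ≡ n

close-suc : ∀ {m n} → Close m n → Close (suc m) (suc n)
close-suc = Sum.map (cong suc) (Sum.map (cong suc) (cong suc))

⌊n/2⌋<m : ∀ {n} m → n < m ℕ.+ m → ⌊ n /2⌋ < m
⌊n/2⌋<m {zero}        (suc m) _        = s≤s z≤n
⌊n/2⌋<m {suc zero}    (suc m) _        = s≤s z≤n
⌊n/2⌋<m {suc (suc n)} (suc m) (s≤s n<) =
  s≤s (⌊n/2⌋<m m (ℕ.≤-pred (subst (suc (suc n) ≤_) (ℕ.+-suc m m) n<)))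

⌊m/2⌋≡⌊n/2⌋⇒close : ∀ m n → ⌊ m /2⌋ ≡ ⌊ n /2⌋ → Close m n
⌊m/2⌋≡⌊n/2⌋⇒close zero          zero          _  = inj₁ refl
⌊m/2⌋≡⌊n/2⌋⇒close zero          (suc zero)    _  = inj₂ (inj₂ refl)
⌊m/2⌋≡⌊n/2⌋⇒close (suc zero)    zero          _  = inj₂ (inj₁ refl)
⌊m/2⌋≡⌊n/2⌋⇒close (suc zero)    (suc zero)    _  = inj₁ refl
⌊m/2⌋≡⌊n/2⌋⇒close (suc (suc m)) (suc (suc n)) eq =
  close-suc (close-suc (⌊m/2⌋≡⌊n/2⌋⇒close m n (ℕ.suc-injective eq)))

module Construction (m : ℕ) (2<m : 2 < m) (prime : Prime (suc (m ℕ.+ m))) where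

  p : ℕ
  p = suc (m ℕ.+ m)

  open Congruence p

  0<m : 0 < m
  0<m = ℕ.<-trans (s≤s z≤n) 2<m

  m<p : m < p
  m<p = s≤s (ℕ.m≤m+n m m)

  0<p : 0 < p
  0<p = s≤s z≤n

  ≉0 : ∀ {n} → 0 < n → n < p → ¬ + n ≋ 0ℤ
  ≉0 0<n n<p n≋0 = ℕ.<⇒≢ 0<n (sym (≋⇒≡ n<p 0<p n≋0))

  1≉0 : ¬ 1ℤ ≋ 0ℤ
  1≉0 = ≉0 ℕ.z<s (ℕ.≤-<-trans 0<m m<p)

  m≉±small : ∀ {n} → n ≤ 2 → ¬ + m ≋ + n × ¬ + m ≋ - + n
  m≉±small {n} n≤2 = (λ e → ℕ.<⇒≢ n<m (sym (≋⇒≡ m<p n<p e)))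
                   , (λ e → ≉0 (ℕ.<-≤-trans 0<m (ℕ.m≤m+n m n)) m+n<p (≋-by (p∣a-b e) (identity (+ m) (+ n))))
    where
    n<m : n < m
    n<m = ℕ.≤-<-trans n≤2 2<m
    n<p : n < p
    n<p = ℕ.<-trans n<m m<p
    m+n<p : m ℕ.+ n < p
    m+n<p = s≤s (ℕ.+-monoʳ-≤ m (ℕ.<⇒≤ n<m))
    identity : ∀ m n → m - - n ≡ (m + n) - 0ℤ
    identity = solve-∀

  ≋-half : ∀ {a b} → a + a ≋ b + b → a ≋ b
  ≋-half {a} {b} (mk≋ d) =
    ≋-by (∣m∣n⇒∣m+n (∣n⇒∣m*n (1ℤ + + m) d) (∣n⇒∣m*n (- (a - b)) ∣-refl)) (identity a b (+ m))
    where
    identity : ∀ a b m → (1ℤ + m) * ((a + a) - (b + b)) + - (a - b) * (1ℤ + (m + m)) ≡ a - b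
    identity = solve-∀

  p∣xy⇒p∣y : ∀ {x y} → ¬ x ≋ 0ℤ → + p ∣ x * y → + p ∣ y
  p∣xy⇒p∣y {x} {y} x≉0 d with euclidsLemma ∣ x ∣ ∣ y ∣ prime (subst (p ℕ.∣_) (ℤ.abs-* x y) (∣⇒∣ᵤ d))
  ... | inj₁ p∣x = ⊥-elim (x≉0 (≋-by (∣ᵤ⇒∣ p∣x) (sym (ℤ.+-identityʳ x))))
  ... | inj₂ p∣y = ∣ᵤ⇒∣ p∣y

  ≋±square⇒≋±1 : ∀ {x} → ¬ x ≋ 0ℤ → x ≋± x * x → x ≋± 1ℤ
  ≋±square⇒≋±1 {x} x≉0 = Sum.map ≋1 ≋-1
    where
    identity₁ : ∀ x → x - x * x ≡ x * (1ℤ - x)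
    identity₁ = solve-∀
    identity₂ : ∀ x → x - - (x * x) ≡ x * (x - -1ℤ)
    identity₂ = solve-∀
    ≋1 : x ≋ x * x → x ≋ 1ℤ
    ≋1 (mk≋ d) = ≋-sym (mk≋ (p∣xy⇒p∣y x≉0 (subst (+ p ∣_) (identity₁ x) d)))
    ≋-1 : x ≋ - (x * x) → x ≋ -1ℤ
    ≋-1 (mk≋ d) = mk≋ (p∣xy⇒p∣y x≉0 (subst (+ p ∣_) (identity₂ x) d))

  InSℤ : ℤ × ℤ → ℤ × ℤ → Set
  InSℤ (a₁ , a₂) (b₁ , b₂) = ∃[ x ] (¬ x ≋ 0ℤ × a₁ - b₁ ≋ x × a₂ - b₂ ≋± x * x)

  InSℤ-sym : ∀ {a b} → InSℤ a b → InSℤ b a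
  InSℤ-sym {a₁ , a₂} {b₁ , b₂} (x , x≉0 , d₁ , d₂) =
    - x , -x≉0 , ≋-by (∣m⇒∣-m (p∣a-b d₁)) (identity₁ a₁ b₁ x) , flip d₂
    where
    -x≉0 : ¬ - x ≋ 0ℤ
    -x≉0 e = x≉0 (≋-trans (≋-reflexive (sym (ℤ.neg-involutive x))) (-‿cong e))
    identity₁ : ∀ a b x → - ((a - b) - x) ≡ (b - a) - - x
    identity₁ = solve-∀
    identity₂ : ∀ a b x → - ((a - b) - x * x) ≡ (b - a) - - (- x * - x)
    identity₂ = solve-∀
    identity₃ : ∀ a b x → - ((a - b) - - (x * x)) ≡ (b - a) - (- x * - x)
    identity₃ = solve-∀
    flip : a₂ - b₂ ≋± x * x → b₂ - a₂ ≋± - x * - x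
    flip (inj₁ e) = inj₂ (≋-by (∣m⇒∣-m (p∣a-b e)) (identity₂ a₂ b₂ x))
    flip (inj₂ e) = inj₁ (≋-by (∣m⇒∣-m (p∣a-b e)) (identity₃ a₂ b₂ x))

  InSℤ-resp : ∀ {a₁ a₂ b₁ b₂ a₁′ a₂′ b₁′ b₂′} → a₁ ≋ a₁′ → a₂ ≋ a₂′ → b₁ ≋ b₁′ → b₂ ≋ b₂′ →
              InSℤ (a₁ , a₂) (b₁ , b₂) → InSℤ (a₁′ , a₂′) (b₁′ , b₂′)
  InSℤ-resp e₁ e₂ f₁ f₂ (x , x≉0 , d₁ , d₂) =
    x , x≉0 , ≋-trans (sub-cong (≋-sym e₁) (≋-sym f₁)) d₁ , ≋±-respˡ (sub-cong (≋-sym e₂) (≋-sym f₂)) d₂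

  ±1-steps⇒InSℤ : ∀ {a₁ a₂ b₁ b₂} → a₁ - b₁ ≋± 1ℤ → a₂ - b₂ ≋± 1ℤ → InSℤ (a₁ , a₂) (b₁ , b₂)
  ±1-steps⇒InSℤ (inj₁ e) d = 1ℤ , 1≉0 , e , d
  ±1-steps⇒InSℤ (inj₂ e) d = -1ℤ , 1≉0 ∘ -‿cong , e , d

  InSℤ-diagonal⇒±1 : ∀ {a b} → InSℤ (a , a) (b , b) → a - b ≋± 1ℤ
  InSℤ-diagonal⇒±1 (x , x≉0 , d₁ , d₂) = ≋±-respˡ d₁ (≋±square⇒≋±1 x≉0 (≋±-respˡ (≋-sym d₁) d₂))

  InSℤ-column-pair⇒midpoint : ∀ {u₁ u₂ a c c′} → InSℤ (u₁ , u₂) (a , c) → InSℤ (u₁ , u₂) (a , c′) →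
                              ¬ c ≋ c′ → u₂ + u₂ ≋ c + c′
  InSℤ-column-pair⇒midpoint {u₁} {u₂} {a} {c} {c′} (x , _ , dx , sx) (y , _ , dy , sy) c≉c′ =
    combine sx (≋±-respʳ (*-cong (≋-sym x≋y) (≋-sym x≋y)) sy)
    where
    x≋y : x ≋ y
    x≋y = ≋-trans (≋-sym dx) dy
    identity₁ : ∀ u c c′ s → ((u - c′) - s) - ((u - c) - s) ≡ c - c′
    identity₁ = solve-∀
    identity₂ : ∀ u c c′ s → ((u - c) - s) + ((u - c′) - - s) ≡ (u + u) - (c + c′)
    identity₂ = solve-∀
    identity₃ : ∀ u c c′ s → ((u - c) - - s) + ((u - c′) - s) ≡ (u + u) - (c + c′)
    identity₃ = solve-∀
    combine : u₂ - c ≋± x * x → u₂ - c′ ≋± x * x → u₂ + u₂ ≋ c + c′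
    combine (inj₁ e) (inj₁ f) =
      ⊥-elim (c≉c′ (≋-by (∣m∣n⇒∣m-n (p∣a-b f) (p∣a-b e)) (identity₁ u₂ c c′ (x * x))))
    combine (inj₁ e) (inj₂ f) = ≋-by (∣m∣n⇒∣m+n (p∣a-b e) (p∣a-b f)) (identity₂ u₂ c c′ (x * x))
    combine (inj₂ e) (inj₁ f) = ≋-by (∣m∣n⇒∣m+n (p∣a-b e) (p∣a-b f)) (identity₃ u₂ c c′ (x * x))
    combine (inj₂ e) (inj₂ f) =
      ⊥-elim (c≉c′ (≋-by (∣m∣n⇒∣m-n (p∣a-b f) (p∣a-b e)) (identity₁ u₂ c c′ (- (x * x)))))

  ι : Fin p → ℤ
  ι a = + toℕ a

  ι-injective : ∀ {a b} → ι a ≋ ι b → a ≡ b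
  ι-injective {a} {b} e = toℕ-injective (≋⇒≡ (toℕ<n a) (toℕ<n b) e)

  ι² : Vtx p → ℤ × ℤ
  ι² (a , b) = ι a , ι b

  InS⇒InSℤ : ∀ {u v} → InS p u v → InSℤ (ι² u) (ι² v)
  InS⇒InSℤ {u₁ , u₂} {v₁ , v₂} (x , 1≤x , x<p , e₁ , e₂) =
    + x , ≉0 1≤x x<p , a≋b+c⇒a-b≋c {ι u₁} {ι v₁} (≡[mod]⇒≋ e₁) , second e₂
    where
    second : toℕ u₂ ≡ toℕ v₂ ℕ.+ x ℕ.* x [mod p ] ⊎ toℕ u₂ ℕ.+ x ℕ.* x ≡ toℕ v₂ [mod p ] →
             ι u₂ - ι v₂ ≋± + x * + x
    second (inj₁ e) =
      inj₁ (a≋b+c⇒a-b≋c {ι u₂} {ι v₂} (subst (λ s → ι u₂ ≋ ι v₂ + s) (ℤ.pos-* x x) (≡[mod]⇒≋ e)))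
    second (inj₂ e) =
      inj₂ (a+c≋b⇒a-b≋-c {ι u₂} {ι v₂} (subst (λ s → ι u₂ + s ≋ ι v₂) (ℤ.pos-* x x) (≡[mod]⇒≋ e)))

  InSℤ⇒InS : ∀ {u v} → InSℤ (ι² u) (ι² v) → InS p u v
  InSℤ⇒InS {u₁ , u₂} {v₁ , v₂} (x , x≉0 , d₁ , d₂) =
    n , 1≤n , n%ℕd<d x p , ≋⇒≡[mod] (a-b≋c⇒a≋b+c {ι u₁} {ι v₁} (≋-trans d₁ (≋-sym n≋x))) , second d₂
    where
    n : ℕ
    n = x %ℕ p
    n≋x : + n ≋ x
    n≋x = %ℕ-≋ x
    1≤n : 1 ≤ n
    1≤n = ℕ.n≢0⇒n>0 (λ n≡0 → x≉0 (≋-trans (≋-sym n≋x) (≋-reflexive (cong +_ n≡0))))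
    x²≋n² : x * x ≋ + (n ℕ.* n)
    x²≋n² = ≋-trans (*-cong (≋-sym n≋x) (≋-sym n≋x)) (≋-reflexive (sym (ℤ.pos-* n n)))
    second : ι u₂ - ι v₂ ≋± x * x →
             toℕ u₂ ≡ toℕ v₂ ℕ.+ n ℕ.* n [mod p ] ⊎ toℕ u₂ ℕ.+ n ℕ.* n ≡ toℕ v₂ [mod p ]
    second (inj₁ e) = inj₁ (≋⇒≡[mod] (a-b≋c⇒a≋b+c {ι u₂} {ι v₂} (≋-trans e x²≋n²)))
    second (inj₂ e) = inj₂ (≋⇒≡[mod] (a-b≋-c⇒a+c≋b {ι u₂} {ι v₂} (≋-trans e (-‿cong x²≋n²))))

  InS-sym : ∀ {u v} → InS p u v → InS p v u
  InS-sym {u} {v} = InSℤ⇒InS {v} {u} ∘ InSℤ-sym {ι² u} {ι² v} ∘ InS⇒InSℤ {u} {v}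

  InS? : ∀ u v → Dec (InS p u v)
  InS? (u₁ , u₂) (v₁ , v₂) =
    map′ (λ (x , x<p , 1≤x , q) → x , 1≤x , x<p , q) (λ (x , 1≤x , x<p , q) → x , x<p , 1≤x , q)
      (ℕ.anyUpTo? (λ x → 1 ℕ.≤? x ×-dec ≡[mod]? _ _ ×-dec (≡[mod]? _ _ ⊎-dec ≡[mod]? _ _)) p)

  ¬InSℤ-same-column : ∀ {a b c} → ¬ InSℤ (a , b) (a , c)
  ¬InSℤ-same-column {a} (x , x≉0 , d₁ , _) = x≉0 (≋-trans (≋-sym d₁) (≋-reflexive (ℤ.+-inverseʳ a)))

  same-column-nonadjacent : ∀ {u v} → proj₁ u ≡ proj₁ v → ¬ InS p u v
  same-column-nonadjacent {u₁ , u₂} {_ , v₂} refl = ¬InSℤ-same-column {ι u₁} {ι u₂} {ι v₂} ∘ InS⇒InSℤ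

  Ḡ : Graph (Vtx p)
  Ḡ = complement (Eberhard p)

  Ḡ-sym : ∀ {u v} → Adj Ḡ u v → Adj Ḡ v u
  Ḡ-sym (u≢v , ¬uv) = u≢v ∘ sym , ¬uv ∘ InS-sym

  -- Kept opaque: unfolded, [ + d ] reduces so far that implicit arguments such as d can no
  -- longer be inferred from diagonalPoint d.
  opaque
    [_] : ℤ → Fin p
    [ z ] = fromℕ< (n%ℕd<d z p)

    ι[z]≋z : ∀ z → ι [ z ] ≋ z
    ι[z]≋z z = ≋-trans (≋-reflexive (cong +_ (toℕ-fromℕ< (n%ℕd<d z p)))) (%ℕ-≋ z)

  ι[a+c]-a≋c : ∀ a c → ι [ a + c ] - a ≋ c
  ι[a+c]-a≋c a c = a≋b+c⇒a-b≋c {b = a} (ι[z]≋z (a + c))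

  data Piece : Set where
    column   : Fin p → Fin m → Piece
    diagonal : Fin m → Piece
    origin   : Piece

  δ : Fin m → ℕ
  δ j = suc (toℕ j)

  δ<p : ∀ j → δ j < p
  δ<p j = ℕ.≤-<-trans (toℕ<n j) m<p

  δ+m<p : ∀ j → δ j ℕ.+ m < p
  δ+m<p j = s≤s (ℕ.+-monoˡ-≤ m (toℕ<n j))

  δ<δ+m : ∀ j k → δ j < δ k ℕ.+ m
  δ<δ+m j k = s≤s (ℕ.≤-trans (toℕ<n j) (ℕ.m≤n+m m (toℕ k)))

  δ-injective : ∀ {j k} → δ j ≡ δ k → j ≡ k
  δ-injective = toℕ-injective ∘ ℕ.suc-injective

  δ≉-δ : ∀ j k → ¬ + δ j ≋ - + δ k
  δ≉-δ j k e =
    ≉0 ℕ.z<s (s≤s (ℕ.+-mono-≤ (toℕ<n j) (toℕ<n k))) (≋-by (p∣a-b e) (identity (+ δ j) (+ δ k)))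
    where
    identity : ∀ a b → a - - b ≡ (a + b) - 0ℤ
    identity = solve-∀

  0≉±δ : ∀ j → ¬ 0ℤ ≋± + δ j
  0≉±δ j (inj₁ e) = ≉0 ℕ.z<s (δ<p j) (≋-sym e)
  0≉±δ j (inj₂ e) = ≉0 ℕ.z<s (δ<p j) (-a≋b⇒a≋-b (≋-sym e))

  ±δ-injective : ∀ {j k} → + δ j ≋± + δ k → j ≡ k
  ±δ-injective {j} {k} (inj₁ e) = δ-injective (≋⇒≡ (δ<p j) (δ<p k) e)
  ±δ-injective {j} {k} (inj₂ e) = ⊥-elim (δ≉-δ j k e)

  upper lower : Fin p → Fin m → Vtx p
  upper a j = a , [ ι a + + δ j ]
  lower a j = a , [ ι a - + δ j ]

  diagonalPoint : ℕ → Vtx p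
  diagonalPoint d = [ + d ] , [ + d ]

  branchSet : Piece → List (Vtx p)
  branchSet (column a j) = upper a j ∷ lower a j ∷ []
  branchSet (diagonal j) = diagonalPoint (δ j) ∷ diagonalPoint (δ j ℕ.+ m) ∷ []
  branchSet origin       = diagonalPoint 0 ∷ []

  branchSet-length : ∀ I → length (branchSet I) ≤ 2
  branchSet-length (column _ _) = ℕ.≤-refl
  branchSet-length (diagonal _) = ℕ.≤-refl
  branchSet-length origin       = s≤s z≤n

  column-member : ∀ {a j v} → v ∈ branchSet (column a j) → proj₁ v ≡ a × ι (proj₂ v) - ι a ≋± + δ j
  column-member {a} {j} (here refl)         = refl , inj₁ (ι[a+c]-a≋c (ι a) (+ δ j))
  column-member {a} {j} (there (here refl)) = refl , inj₂ (ι[a+c]-a≋c (ι a) (- + δ j))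

  upper≉lower : ∀ a j → ¬ ι (proj₂ (upper a j)) ≋ ι (proj₂ (lower a j))
  upper≉lower a j e = δ≉-δ j j (begin
    + δ j                         ≈⟨ ι[a+c]-a≋c (ι a) (+ δ j) ⟨
    ι [ ι a + + δ j ] - ι a       ≈⟨ sub-cong e (≋-refl {ι a}) ⟩
    ι [ ι a - + δ j ] - ι a       ≈⟨ ι[a+c]-a≋c (ι a) (- + δ j) ⟩
    - + δ j                       ∎)
    where open ≋-Reasoning

  column-off-diagonal : ∀ {a j v} → v ∈ branchSet (column a j) → proj₁ v ≢ proj₂ v
  column-off-diagonal {j = j} {v₁ , _} v∈ refl with column-member v∈
  ... | refl , s = 0≉±δ j (≋±-respˡ (≋-reflexive (sym (ℤ.+-inverseʳ (ι v₁)))) s)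

  diagonalPoint-injective : ∀ {d e} → d < p → e < p → diagonalPoint d ≡ diagonalPoint e → d ≡ e
  diagonalPoint-injective {d} {e} d<p e<p eq =
    ≋⇒≡ d<p e<p (≋-trans (≋-sym (ι[z]≋z (+ d))) (≋-trans (≋-reflexive (cong (ι ∘ proj₁) eq)) (ι[z]≋z (+ e))))

  m-gap≉±1 : ∀ a → ¬ a - (a + + m) ≋± 1ℤ
  m-gap≉±1 a = Sum.[ proj₂ (m≉±small ℕ.z<s) ∘ via , proj₁ (m≉±small ℕ.z<s) ∘ via ]
    where
    identity : ∀ a m s → - ((a - (a + m)) - s) ≡ m - - s
    identity = solve-∀
    via : ∀ {s} → a - (a + + m) ≋ s → + m ≋ - s
    via {s} (mk≋ d) = ≋-by (∣m⇒∣-m d) (identity a (+ m) s)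

  unit-gaps-not-m-apart : ∀ {a b} → a - b ≋± 1ℤ → ¬ a - (b + + m) ≋± 1ℤ
  unit-gaps-not-m-apart {a} {b} = excluded
    where
    identity : ∀ a b m s t → ((a - b) - s) - ((a - (b + m)) - t) ≡ m - (s - t)
    identity = solve-∀
    m≋s-t : ∀ {s t} → a - b ≋ s → a - (b + + m) ≋ t → + m ≋ s - t
    m≋s-t {s} {t} e f = ≋-by (∣m∣n⇒∣m-n (p∣a-b e) (p∣a-b f)) (identity a b (+ m) s t)
    excluded : a - b ≋± 1ℤ → ¬ a - (b + + m) ≋± 1ℤ
    excluded (inj₁ e) (inj₁ f) = proj₁ (m≉±small z≤n) (m≋s-t e f)
    excluded (inj₁ e) (inj₂ f) = proj₁ (m≉±small ℕ.≤-refl) (m≋s-t e f)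
    excluded (inj₂ e) (inj₁ f) = proj₂ (m≉±small ℕ.≤-refl) (m≋s-t e f)
    excluded (inj₂ e) (inj₂ f) = proj₁ (m≉±small z≤n) (m≋s-t e f)

  diagonalPoint-InS : ∀ {d e} → InS p (diagonalPoint d) (diagonalPoint e) → + d - + e ≋± 1ℤ
  diagonalPoint-InS {d} {e} uv =
    ≋±-respˡ (sub-cong (≋-sym (ι[z]≋z (+ d))) (≋-sym (ι[z]≋z (+ e))))
             (InSℤ-diagonal⇒±1 {ι [ + d ]} {ι [ + e ]} (InS⇒InSℤ uv))

  column-ends-Ḡ : ∀ a j → Adj Ḡ (upper a j) (lower a j)
  column-ends-Ḡ a j = upper≉lower a j ∘ ≋-reflexive ∘ cong (ι ∘ proj₂) , same-column-nonadjacent refl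

  diagonal-ends-Ḡ : ∀ j → Adj Ḡ (diagonalPoint (δ j)) (diagonalPoint (δ j ℕ.+ m))
  diagonal-ends-Ḡ j =
    ℕ.<⇒≢ (δ<δ+m j j) ∘ diagonalPoint-injective (δ<p j) (δ+m<p j) , m-gap≉±1 (+ δ j) ∘ diagonalPoint-InS

  branchSet-unique : ∀ I → Unique (branchSet I)
  branchSet-unique (column a j) = (proj₁ (column-ends-Ḡ a j) ∷ []) ∷ [] ∷ []
  branchSet-unique (diagonal j) = (proj₁ (diagonal-ends-Ḡ j) ∷ []) ∷ [] ∷ []
  branchSet-unique origin       = [] ∷ []

  branchSet-connected : ∀ I → InducesConnected Ḡ (branchSet I)
  branchSet-connected (column a j) = pair-connected (column-ends-Ḡ a j) (Ḡ-sym (column-ends-Ḡ a j))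
  branchSet-connected (diagonal j) = pair-connected (diagonal-ends-Ḡ j) (Ḡ-sym (diagonal-ends-Ḡ j))
  branchSet-connected origin       = singleton-connected _

  columns-disjoint : ∀ {a j b k v} → v ∈ branchSet (column a j) → v ∈ branchSet (column b k) →
                     column a j ≡ column b k
  columns-disjoint v∈I v∈J with column-member v∈I | column-member v∈J
  ... | refl , s | refl , t = cong (column _) (±δ-injective (≋±-cancel s t))

  diagonalPoint∉column : ∀ {d a j} → ¬ diagonalPoint d ∈ branchSet (column a j)
  diagonalPoint∉column d∈ = column-off-diagonal d∈ refl

  diagonals-disjoint : ∀ {j k d} → diagonalPoint d ∈ branchSet (diagonal j) →
                       diagonalPoint d ∈ branchSet (diagonal k) → j ≡ k
  diagonals-disjoint {j} {k} (here e) (here f) =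
    δ-injective (diagonalPoint-injective (δ<p j) (δ<p k) (trans (sym e) f))
  diagonals-disjoint {j} {k} (here e) (there (here f)) =
    ⊥-elim (ℕ.<⇒≢ (δ<δ+m j k) (diagonalPoint-injective (δ<p j) (δ+m<p k) (trans (sym e) f)))
  diagonals-disjoint {j} {k} (there (here e)) (here f) =
    ⊥-elim (ℕ.<⇒≢ (δ<δ+m k j) (diagonalPoint-injective (δ<p k) (δ+m<p j) (trans (sym f) e)))
  diagonals-disjoint {j} {k} (there (here e)) (there (here f)) =
    δ-injective (ℕ.+-cancelʳ-≡ m _ _ (diagonalPoint-injective (δ+m<p j) (δ+m<p k) (trans (sym e) f)))

  origin∉diagonal : ∀ {j} → ¬ diagonalPoint 0 ∈ branchSet (diagonal j)
  origin∉diagonal {j} (here e)         = ℕ.<⇒≢ ℕ.z<s (diagonalPoint-injective 0<p (δ<p j) e)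
  origin∉diagonal {j} (there (here e)) = ℕ.<⇒≢ ℕ.z<s (diagonalPoint-injective 0<p (δ+m<p j) e)

  branchSet-disjoint : ∀ I J {v} → v ∈ branchSet I → v ∈ branchSet J → I ≡ J
  branchSet-disjoint (column _ _) (column _ _) v∈I v∈J = columns-disjoint v∈I v∈J
  branchSet-disjoint (column _ _) (diagonal _) v∈I (here refl)         = ⊥-elim (diagonalPoint∉column v∈I)
  branchSet-disjoint (column _ _) (diagonal _) v∈I (there (here refl)) = ⊥-elim (diagonalPoint∉column v∈I)
  branchSet-disjoint (column _ _) origin       v∈I (here refl)         = ⊥-elim (diagonalPoint∉column v∈I)
  branchSet-disjoint (diagonal _) (column _ _) (here refl)         v∈J = ⊥-elim (diagonalPoint∉column v∈J)
  branchSet-disjoint (diagonal _) (column _ _) (there (here refl)) v∈J = ⊥-elim (diagonalPoint∉column v∈J)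
  branchSet-disjoint origin       (column _ _) (here refl)         v∈J = ⊥-elim (diagonalPoint∉column v∈J)
  branchSet-disjoint (diagonal _) (diagonal _) (here refl)         v∈J =
    cong diagonal (diagonals-disjoint (here refl) v∈J)
  branchSet-disjoint (diagonal _) (diagonal _) (there (here refl)) v∈J =
    cong diagonal (diagonals-disjoint (there (here refl)) v∈J)
  branchSet-disjoint (diagonal _) origin (here refl)         (here e) =
    ⊥-elim (origin∉diagonal (here (sym e)))
  branchSet-disjoint (diagonal _) origin (there (here refl)) (here e) =
    ⊥-elim (origin∉diagonal (there (here (sym e))))
  branchSet-disjoint origin (diagonal _) (here refl) v∈J = ⊥-elim (origin∉diagonal v∈J)
  branchSet-disjoint origin origin       _           _   = refl

  adjacent-to-upper-and-lower : ∀ {u a j} → InS p u (upper a j) → InS p u (lower a j) → ι (proj₂ u) ≋ ι a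
  adjacent-to-upper-and-lower {u₁ , u₂} {a} {j} adj⁺ adj⁻ =
    ≋-half (≋-trans (InSℤ-column-pair⇒midpoint {ι u₁} {ι u₂} {ι a}
                       (InS⇒InSℤ adj⁺) (InS⇒InSℤ adj⁻) (upper≉lower a j))
                    ends-sum)
    where
    identity : ∀ a d → (a + d) + (a - d) ≡ a + a
    identity = solve-∀
    ends-sum : ι (proj₂ (upper a j)) + ι (proj₂ (lower a j)) ≋ ι a + ι a
    ends-sum = ≋-trans (+-cong (ι[z]≋z _) (ι[z]≋z _)) (≋-reflexive (identity (ι a) (+ δ j)))

  column-avoids : ∀ a j b → ∃[ u ] (u ∈ branchSet (column a j) × ¬ ι (proj₂ u) ≋ ι b)
  column-avoids a j b with ι (proj₂ (upper a j)) ≋? ι b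
  ... | no  ≉b = upper a j , here refl , ≉b
  ... | yes ≋b = lower a j , there (here refl) , λ ≋b′ → upper≉lower a j (≋-trans ≋b (≋-sym ≋b′))

  data Meet (I J : Piece) : Set where
    meet : ∀ {u v} → u ∈ branchSet I → v ∈ branchSet J → Adj Ḡ u v → Meet I J

  Meet-sym : ∀ {I J} → Meet I J → Meet J I
  Meet-sym (meet u∈ v∈ uv) = meet v∈ u∈ (Ḡ-sym uv)

  -- Only vertices (a′ , a) with a′ ≠ a can be S-adjacent to both vertices of a column piece at a.
  column-meets : ∀ {I u} a j → u ∈ branchSet I → (proj₁ u ≢ a → ¬ ι (proj₂ u) ≋ ι a) → Meet I (column a j)
  column-meets {u = u₁ , u₂} a j u∈ avoids with u₁ Fin.≟ a
  ... | yes refl with u₂ Fin.≟ proj₂ (upper u₁ j)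
  ...   | yes refl = meet u∈ (there (here refl)) (proj₁ (column-ends-Ḡ u₁ j) , same-column-nonadjacent refl)
  ...   | no  u₂≢  = meet u∈ (here refl) (u₂≢ ∘ cong proj₂ , same-column-nonadjacent refl)
  column-meets {u = u} a j u∈ avoids | no u₁≢a with InS? u (upper a j) | InS? u (lower a j)
  ... | no ¬adj  | _        = meet u∈ (here refl) (u₁≢a ∘ cong proj₁ , ¬adj)
  ... | yes _    | no ¬adj  = meet u∈ (there (here refl)) (u₁≢a ∘ cong proj₁ , ¬adj)
  ... | yes adj⁺ | yes adj⁻ = ⊥-elim (avoids u₁≢a (adjacent-to-upper-and-lower adj⁺ adj⁻))

  diagonalPoint-meets-column : ∀ {I d} → diagonalPoint d ∈ branchSet I → ∀ a j → Meet I (column a j)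
  diagonalPoint-meets-column d∈ a j = column-meets a j d∈ (λ ≢a → ≢a ∘ ι-injective)

  diagonalPoint-meets-diagonal : ∀ {I d} → diagonalPoint d ∈ branchSet I → d < p →
                                 ∀ j → d ≢ δ j → d ≢ δ j ℕ.+ m → Meet I (diagonal j)
  diagonalPoint-meets-diagonal {d = d} d∈ d<p j d≢δ d≢δ+m
    with InS? (diagonalPoint d) (diagonalPoint (δ j)) | InS? (diagonalPoint d) (diagonalPoint (δ j ℕ.+ m))
  ... | no ¬adj | _       = meet d∈ (here refl) (d≢δ ∘ diagonalPoint-injective d<p (δ<p j) , ¬adj)
  ... | yes _   | no ¬adj = meet d∈ (there (here refl)) (d≢δ+m ∘ diagonalPoint-injective d<p (δ+m<p j) , ¬adj)
  ... | yes adj | yes adj′ =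
    ⊥-elim (unit-gaps-not-m-apart {+ d} {+ δ j} (diagonalPoint-InS adj) (diagonalPoint-InS adj′))

  pieces-meet : ∀ I J → I ≢ J → Meet I J
  pieces-meet (column a j) (column b k) _ with column-avoids a j b
  ... | _ , u∈ , u≉b = column-meets b k u∈ (λ _ → u≉b)
  pieces-meet (column a j) (diagonal k) _ = Meet-sym (diagonalPoint-meets-column (here refl) a j)
  pieces-meet (column a j) origin       _ = Meet-sym (diagonalPoint-meets-column (here refl) a j)
  pieces-meet (diagonal j) (column a k) _ = diagonalPoint-meets-column (here refl) a k
  pieces-meet origin       (column a k) _ = diagonalPoint-meets-column (here refl) a k
  pieces-meet (diagonal j) (diagonal k) j≢k =
    diagonalPoint-meets-diagonal (here refl) (δ<p j) k (j≢k ∘ cong diagonal ∘ δ-injective) (ℕ.<⇒≢ (δ<δ+m j k))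
  pieces-meet (diagonal j) origin _ = Meet-sym (diagonalPoint-meets-diagonal (here refl) 0<p j (λ ()) (λ ()))
  pieces-meet origin (diagonal k) _ = diagonalPoint-meets-diagonal (here refl) 0<p k (λ ()) (λ ())
  pieces-meet origin origin origin≢origin = ⊥-elim (origin≢origin refl)

  model : Model Ḡ Piece
  model = record
    { branch    = branchSet
    ; unique    = branchSet-unique
    ; connected = branchSet-connected
    ; disjoint  = λ I J I≢J v v∈I v∈J → I≢J (branchSet-disjoint I J v∈I v∈J)
    ; adjacent  = λ I J I≢J → witnesses (pieces-meet I J I≢J)
    }
    where
    witnesses : ∀ {I J} → Meet I J → ∃[ u ] ∃[ v ] (u ∈ branchSet I × v ∈ branchSet J × Adj Ḡ u v)
    witnesses (meet u∈ v∈ uv) = _ , _ , u∈ , v∈ , uv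

  -- 1 + m is the inverse of 2 modulo p.
  halve : ℤ → ℕ
  halve z = (z * (1ℤ + + m)) %ℕ p

  halve<p : ∀ z → halve z < p
  halve<p z = n%ℕd<d (z * (1ℤ + + m)) p

  halve≋ : ∀ z → + halve z + + halve z ≋ z
  halve≋ z = ≋-by (∣m∣n⇒∣m+n (∣m∣n⇒∣m+n d d) (∣n⇒∣m*n z ∣-refl)) (identity (+ halve z) z (+ m))
    where
    d : + p ∣ + halve z - z * (1ℤ + + m)
    d = p∣a-b (%ℕ-≋ (z * (1ℤ + + m)))
    identity : ∀ h z m → ((h - z * (1ℤ + m)) + (h - z * (1ℤ + m))) + z * (1ℤ + (m + m)) ≡ (h + h) - z
    identity = solve-∀

  halfDiff halfSum : Vtx p → ℕ
  halfDiff (a , b) = halve (ι a - ι b)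
  halfSum  (a , b) = halve (ι a + ι b)

  halfDiff+halfSum≋ : ∀ u → + halfDiff u + + halfSum u ≋ ι (proj₁ u)
  halfDiff+halfSum≋ (a , b) =
    ≋-half (≋-by (∣m∣n⇒∣m+n (p∣a-b (halve≋ (ι a - ι b))) (p∣a-b (halve≋ (ι a + ι b))))
                 (identity (+ halfDiff (a , b)) (+ halfSum (a , b)) (ι a) (ι b)))
    where
    identity : ∀ t h a b → ((t + t) - (a - b)) + ((h + h) - (a + b)) ≡ ((t + h) + (t + h)) - (a + a)
    identity = solve-∀

  halfSum-halfDiff≋ : ∀ u → + halfSum u - + halfDiff u ≋ ι (proj₂ u)
  halfSum-halfDiff≋ (a , b) =
    ≋-half (≋-by (∣m∣n⇒∣m-n (p∣a-b (halve≋ (ι a + ι b))) (p∣a-b (halve≋ (ι a - ι b))))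
                 (identity (+ halfDiff (a , b)) (+ halfSum (a , b)) (ι a) (ι b)))
    where
    identity : ∀ t h a b → ((h + h) - (a + b)) - ((t + t) - (a - b)) ≡ ((h - t) + (h - t)) - (b + b)
    identity = solve-∀

  halves-determine-vertex : ∀ u v → halfDiff u ≡ halfDiff v → halfSum u ≡ halfSum v → u ≡ v
  halves-determine-vertex u v t≡ h≡ =
    cong₂ _,_ (ι-injective (via halfDiff+halfSum≋ (cong₂ (λ t h → + t + + h) t≡ h≡)))
              (ι-injective (via halfSum-halfDiff≋ (cong₂ (λ t h → + h - + t) t≡ h≡)))
    where
    via : ∀ {f : Vtx p → ℤ} {g : Vtx p → ℤ} → (∀ w → g w ≋ f w) → g u ≡ g v → f u ≋ f v
    via g≋f eq = ≋-trans (≋-sym (g≋f u)) (≋-trans (≋-reflexive eq) (g≋f v))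

  axisPiece : (t : ℕ) → Dec (t < m ℕ.+ m) → Piece
  axisPiece t (yes t<2m) = diagonal (fromℕ< (⌊n/2⌋<m m t<2m))
  axisPiece t (no _)     = origin

  pieceAt : (t h : ℕ) → t < p → h < p → Piece
  pieceAt t zero    _   _   = axisPiece t (t <? m ℕ.+ m)
  pieceAt t (suc h) t<p h<p = column (fromℕ< t<p) (fromℕ< (⌊n/2⌋<m m (ℕ.s<s⁻¹ h<p)))

  colour : Vtx p → Piece
  colour (a , b) =
    pieceAt (halve (ι a - ι b)) (halve (ι a + ι b)) (halve<p (ι a - ι b)) (halve<p (ι a + ι b))

  column-injective : ∀ {a b j k} → column a j ≡ column b k → a ≡ b × j ≡ k
  column-injective refl = refl , refl

  diagonal-injective : ∀ {j k} → diagonal j ≡ diagonal k → j ≡ k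
  diagonal-injective refl = refl

  axisPiece≢column : ∀ {t a j} d → axisPiece t d ≢ column a j
  axisPiece≢column (yes _) ()
  axisPiece≢column (no _)  ()

  axisPiece-injective : ∀ {t t′} → t < p → t′ < p → ∀ d d′ → axisPiece t d ≡ axisPiece t′ d′ → Close t t′
  axisPiece-injective {t} {t′} _ _ (yes t<) (yes t′<) eq =
    ⌊m/2⌋≡⌊n/2⌋⇒close t t′ (fromℕ<-injective _ _ _ _ (diagonal-injective eq))
  axisPiece-injective t<p t′<p (no t≮) (no t′≮) _ = inj₁ (trans (top t<p t≮) (sym (top t′<p t′≮)))
    where
    top : ∀ {t} → t < p → ¬ t < m ℕ.+ m → t ≡ m ℕ.+ m
    top t<p t≮ = ℕ.≤-antisym (ℕ.≤-pred t<p) (ℕ.≮⇒≥ t≮)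
  axisPiece-injective _ _ (yes _) (no _) ()
  axisPiece-injective _ _ (no _) (yes _) ()

  data SameClass : ℕ → ℕ → ℕ → ℕ → Set where
    vertical   : ∀ {t h h′} → Close h h′ → SameClass t h t h′
    horizontal : ∀ {t t′} → Close t t′ → SameClass t 0 t′ 0

  pieceAt-sameClass : ∀ {t h t′ h′} t<p h<p t′<p h′<p → pieceAt t h t<p h<p ≡ pieceAt t′ h′ t′<p h′<p →
                      SameClass t h t′ h′
  pieceAt-sameClass {t} {zero} {t′} {zero} t<p _ t′<p _ eq =
    horizontal (axisPiece-injective t<p t′<p (t <? m ℕ.+ m) (t′ <? m ℕ.+ m) eq)
  pieceAt-sameClass {t} {zero} {h′ = suc _} _ _ _ _ eq = ⊥-elim (axisPiece≢column (t <? m ℕ.+ m) eq)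
  pieceAt-sameClass {h = suc _} {t′} {zero} _ _ _ _ eq = ⊥-elim (axisPiece≢column (t′ <? m ℕ.+ m) (sym eq))
  pieceAt-sameClass {t} {suc h} {t′} {suc h′} _ _ _ _ eq with column-injective eq
  ... | t≡ , h≡ with fromℕ<-injective t t′ _ _ t≡
  ...   | refl = vertical (close-suc (⌊m/2⌋≡⌊n/2⌋⇒close h h′ (fromℕ<-injective _ _ _ _ h≡)))

  close⇒≡⊎≋±1 : ∀ {n n′} → Close n n′ → n ≡ n′ ⊎ + n - + n′ ≋± 1ℤ
  close⇒≡⊎≋±1 (inj₁ n≡n′)                = inj₁ n≡n′
  close⇒≡⊎≋±1 {n′ = n′} (inj₂ (inj₁ refl)) = inj₂ (inj₁ (≋-reflexive (identity (+ n′))))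
    where
    identity : ∀ x → (1ℤ + x) - x ≡ 1ℤ
    identity = solve-∀
  close⇒≡⊎≋±1 {n} (inj₂ (inj₂ refl))       = inj₂ (inj₂ (≋-reflexive (identity (+ n))))
    where
    identity : ∀ x → x - (1ℤ + x) ≡ - 1ℤ
    identity = solve-∀

  sameClass⇒InSℤ : ∀ {t h t′ h′} → SameClass t h t′ h′ →
                   t ≡ t′ × h ≡ h′ ⊎ InSℤ (+ t + + h , + h - + t) (+ t′ + + h′ , + h′ - + t′)
  sameClass⇒InSℤ {t} {h} {_} {h′} (vertical c) with close⇒≡⊎≋±1 c
  ... | inj₁ refl = inj₁ (refl , refl)
  ... | inj₂ d    = inj₂ (±1-steps⇒InSℤ {+ t + + h} {+ h - + t} {+ t + + h′} {+ h′ - + t}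
                                    (≋±-respˡ (≋-reflexive (identity₁ (+ t) (+ h) (+ h′))) d)
                                    (≋±-respˡ (≋-reflexive (identity₂ (+ t) (+ h) (+ h′))) d))
    where
    identity₁ : ∀ t h h′ → (t + h) - (t + h′) ≡ h - h′
    identity₁ = solve-∀
    identity₂ : ∀ t h h′ → (h - t) - (h′ - t) ≡ h - h′
    identity₂ = solve-∀
  sameClass⇒InSℤ {t} {_} {t′} (horizontal c) with close⇒≡⊎≋±1 c
  ... | inj₁ refl = inj₁ (refl , refl)
  ... | inj₂ d    = inj₂ (±1-steps⇒InSℤ {+ t + 0ℤ} {0ℤ - + t} {+ t′ + 0ℤ} {0ℤ - + t′}
                                    (≋±-respˡ (≋-reflexive (identity₁ (+ t) (+ t′))) d)
                                    (≋±-respˡ (≋-reflexive (identity₂ (+ t) (+ t′))) (-‿≋± d)))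
    where
    identity₁ : ∀ t t′ → (t + 0ℤ) - (t′ + 0ℤ) ≡ t - t′
    identity₁ = solve-∀
    identity₂ : ∀ t t′ → (0ℤ - t) - (0ℤ - t′) ≡ - (t - t′)
    identity₂ = solve-∀

  colour-classes-are-cliques : ∀ u v → colour u ≡ colour v → u ≢ v → InS p u v
  colour-classes-are-cliques u@(_ , _) v@(_ , _) eq u≢v
    with sameClass⇒InSℤ (pieceAt-sameClass _ _ _ _ eq)
  ... | inj₁ (t≡ , h≡) = ⊥-elim (u≢v (halves-determine-vertex u v t≡ h≡))
  ... | inj₂ adj       = InSℤ⇒InS {u} {v} (InSℤ-resp (halfDiff+halfSum≋ u) (halfSum-halfDiff≋ u)
                                                    (halfDiff+halfSum≋ v) (halfSum-halfDiff≋ v) adj)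

  K : ℕ
  K = p ℕ.* m ℕ.+ suc m

  Piece↔⊎ : Piece ↔ ((Fin p × Fin m) ⊎ Fin (suc m))
  Piece↔⊎ = mk↔ₛ′ to from to∘from from∘to
    where
    to : Piece → (Fin p × Fin m) ⊎ Fin (suc m)
    to (column a j) = inj₁ (a , j)
    to (diagonal j) = inj₂ (Fin.suc j)
    to origin       = inj₂ Fin.zero
    from : (Fin p × Fin m) ⊎ Fin (suc m) → Piece
    from (inj₁ (a , j))     = column a j
    from (inj₂ (Fin.suc j)) = diagonal j
    from (inj₂ Fin.zero)    = origin
    to∘from : ∀ x → to (from x) ≡ x
    to∘from (inj₁ _)           = refl
    to∘from (inj₂ (Fin.suc _)) = refl
    to∘from (inj₂ Fin.zero)    = refl
    from∘to : ∀ I → from (to I) ≡ I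
    from∘to (column _ _) = refl
    from∘to (diagonal _) = refl
    from∘to origin       = refl

  Piece↔Fin : Piece ↔ Fin K
  Piece↔Fin = ↔-trans Piece↔⊎ (↔-sym (↔-trans +↔⊎ (*↔× ⊎-↔ ↔-refl)))

  colourable : Colourable Ḡ K
  colourable =
    to ∘ colour , λ u v (u≢v , ¬uv) eq → ¬uv (colour-classes-are-cliques u v (injective eq) u≢v)
    where open Injection (↔⇒↣ Piece↔Fin)

  small-model : ∀ {k} → k ≤ K → Σ (KModel Ḡ k) λ M → ∀ i → length (branch M i) ≤ 2
  small-model {k} k≤K = Model⇒KModel model f , branchSet-length ∘ Injection.to f
    where
    f : Fin k ↣ Piece
    f = ↔⇒↣ (↔-sym Piece↔Fin) ↣-∘ mk↣ (inject≤-injective k≤K k≤K _ _)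

small-Kχ-model : ∀ {p} m → 2 < m → p ≡ suc (m ℕ.+ m) → Prime p →
  ∀ k → IsChromaticNumber (complement (Eberhard p)) k →
  Σ (KModel (complement (Eberhard p)) k) λ M → ∀ i → length (branch M i) ≤ 2
small-Kχ-model m 2<m refl p-prime k χ = small-model (chromatic-number-≤ χ colourable)
  where open Construction m 2<m p-prime

p%12≡11⇒p≡1+2m : ∀ {p} → p % 12 ≡ 11 → ∃[ m ] (2 < m × p ≡ suc (m ℕ.+ m))
p%12≡11⇒p≡1+2m {p} p%12≡11 = 5 ℕ.+ 6 ℕ.* (p / 12) , s≤s (s≤s (s≤s z≤n)) , (begin
  p                          ≡⟨ m≡m%n+[m/n]*n p 12 ⟩
  p % 12 ℕ.+ (p / 12) ℕ.* 12 ≡⟨ cong (ℕ._+ (p / 12) ℕ.* 12) p%12≡11 ⟩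
  11 ℕ.+ (p / 12) ℕ.* 12     ≡⟨ identity (p / 12) ⟩
  suc ((5 ℕ.+ 6 ℕ.* (p / 12)) ℕ.+ (5 ℕ.+ 6 ℕ.* (p / 12))) ∎)
  where
  open ≡-Reasoning
  identity : ∀ q → 11 ℕ.+ q ℕ.* 12 ≡ suc ((5 ℕ.+ 6 ℕ.* q) ℕ.+ (5 ℕ.+ 6 ℕ.* q))
  identity = ℕ-Solver.solve-∀

theorem3p22 : (p : ℕ) → Prime p → p % 12 ≡ 11 →
    (k : ℕ) → IsChromaticNumber (complement (Eberhard p)) k →
    Σ (KModel (complement (Eberhard p)) k) λ M → ∀ i → length (branch M i) ≤ 2
theorem3p22 p p-prime p%12≡11 =
  let m , 2<m , p≡1+2m = p%12≡11⇒p≡1+2m p%12≡11 in small-Kχ-model m 2<m p≡1+2m p-prime
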